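{- Let $M$ be a $3$-connected matroid with $P\subseteq E(M)$ such that $M|P\cong U_{3,5}$. Then $M\backslash p$ is $3$-connected for each $p\in\operatorname{cl}(P)-P$. -}

module Defs where

open import Data.Nat using (ℕ; _+_; _∸_; _≤_; _<_; _⊓_)
open import Data.Fin using (Fin)
open import Data.Fin.Subset using (Subset; _∪_; _∩_; _⊆_; _─_; _-_; ⁅_⁆; ⊤; ⋃; ∣_∣; _∈_; _∉_)
open import Data.List using (map; allFin)
open import Data.Vec using (lookup)
open import Data.Bool using (if_then_else_)
open import Data.Product using (Σ; _×_)
open import Function.Definitions using (Injective)
open import Relation.Binary.PropositionalEquality using (_≡_)
open import Relation.Nullary using (¬_)

record Matroid (n : ℕ) : Set where
  field
    rank        : Subset n → ℕ
    rank-≤-card : ∀ X → rank X ≤ ∣ X ∣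
    rank-mono   : ∀ {X Y} → X ⊆ Y → rank X ≤ rank Y
    rank-submod : ∀ X Y → rank (X ∪ Y) + rank (X ∩ Y) ≤ rank X + rank Y
open Matroid public

-- The uniform matroid U_{r,m} on Fin m: rank X = min(|X|, r).
-- (Only its rank function is needed; isomorphism below compares rank functions.)
uniformRank : (r m : ℕ) → Subset m → ℕ
uniformRank r m X = ∣ X ∣ ⊓ r

image : ∀ {m n} → (Fin m → Fin n) → Subset m → Subset n
image {m} f Y = ⋃ (map (λ i → if lookup Y i then ⁅ f i ⁆ else Data.Fin.Subset.⊥) (allFin m))

RestrictionIsoUniform : ∀ {n} → Matroid n → Subset n → (r m : ℕ) → Set
RestrictionIsoUniform {n} M S r m =
  Σ (Fin m → Fin n) λ f →
    Injective _≡_ _≡_ f ×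
    image f ⊤ ≡ S ×
    (∀ Y → rank M (image f Y) ≡ uniformRank r m Y)

InClosure : ∀ {n} → Matroid n → Subset n → Fin n → Set
InClosure M X x = rank M (X ∪ ⁅ x ⁆) ≡ rank M X

-- Connectivity function of the restriction M|S (ground set S):
-- λ_{M|S}(X) = r(X) + r(S − X) − r(S), for X ⊆ S.
connectivity : ∀ {n} → Matroid n → Subset n → Subset n → ℕ
connectivity M S X = rank M X + rank M (S ─ X) ∸ rank M S

IsSeparation : ∀ {n} → Matroid n → Subset n → ℕ → Subset n → Set
IsSeparation M S k X =
  X ⊆ S × k ≤ ∣ X ∣ × k ≤ ∣ S ─ X ∣ × connectivity M S X < k

ThreeConnectedOn : ∀ {n} → Matroid n → Subset n → Set
ThreeConnectedOn M S = ∀ k → 1 ≤ k → k < 3 → ∀ X → ¬ IsSeparation M S k X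

ThreeConnected : ∀ {n} → Matroid n → Set
ThreeConnected M = ThreeConnectedOn M ⊤

-- Of the five points of P, one side of any partition of E − p keeps at least three;
-- they span the rank-3 set P and hence p. Adding p to that side of a 1- or 2-separation
-- of M \ p leaves its rank unchanged, and r(E) ≥ r(E − p), so this gives a separation
-- of M of the same order.
module Submission where

open import Defs
open import Data.Nat using (ℕ; suc; s≤s; _+_; _∸_; _≤_; _<_; _⊓_)
open import Data.Nat.Properties
  using (≤-trans; ≤-reflexive; ≤-antisym; ≤-<-trans; +-mono-≤; +-cancelʳ-≤; m≤m+n;
         +-comm; ∸-monoʳ-≤; m+n∸m≡n; m≥n⇒m⊓n≡n; _≤?_; ≰⇒>; module ≤-Reasoning)
open import Data.Fin using (Fin; zero; suc)
open import Data.Fin.Subset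
open import Data.Fin.Subset.Properties
open import Data.Vec using (_∷_; lookup; tabulate; here; there)
open import Data.Vec.Properties using ([]=⇒lookup; lookup⇒[]=; lookup∘tabulate)
open import Data.List using (List; map; allFin) renaming (_∷_ to _∷ₗ_; [] to []ₗ)
open import Data.List.Relation.Unary.Any using () renaming (here to hereₗ; there to thereₗ)
import Data.List.Membership.Propositional as List
open import Data.List.Membership.Propositional.Properties using (∈-allFin)
open import Data.Bool using (true; false; if_then_else_)
open import Data.Product using (_×_; _,_; proj₁; proj₂; ∃)
open import Data.Sum using (_⊎_; inj₁; inj₂; [_,_]′)
import Data.Sum as Sum
open import Function using (_∘_; id)
open import Relation.Binary.PropositionalEquality
  using (_≡_; refl; sym; trans; cong; cong₂; subst; module ≡-Reasoning)
open import Relation.Nullary using (¬_; yes; no; contradiction)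

private
  variable
    m n : ℕ

x∈p─q⁻ : ∀ (p q : Subset n) {x} → x ∈ p ─ q → x ∈ p × x ∉ q
x∈p─q⁻ (true  ∷ p) (false ∷ q) {zero}  here = here , λ ()
x∈p─q⁻ (false ∷ p) (false ∷ q) {zero}  ()
x∈p─q⁻ (_     ∷ p) (true  ∷ q) {zero}  ()
x∈p─q⁻ (_     ∷ p) (_     ∷ q) {suc _} (there h) with x∈p─q⁻ p q h
... | x∈p , x∉q = there x∈p , x∉q ∘ drop-there

p─[p─q]≡q : ∀ {p q : Subset n} → q ⊆ p → p ─ (p ─ q) ≡ q
p─[p─q]≡q {p = p} {q} q⊆p = ⊆-antisym ⊆q q⊆
  where
    ⊆q : p ─ (p ─ q) ⊆ q
    ⊆q {x} h with x∈p─q⁻ p (p ─ q) h | x ∈? q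
    ... | _   , _        | yes x∈q = x∈q
    ... | x∈p , x∉p─q | no  x∉q = contradiction (x∈p∧x∉q⇒x∈p─q x∈p x∉q) x∉p─q
    q⊆ : q ⊆ p ─ (p ─ q)
    q⊆ x∈q = x∈p∧x∉q⇒x∈p─q (q⊆p x∈q) (λ x∈p─q → proj₂ (x∈p─q⁻ p q x∈p─q) x∈q)

∣p∣>k⊎∣∁p∣>k : ∀ {k} (p : Subset (k + suc k)) → k < ∣ p ∣ ⊎ k < ∣ ∁ p ∣
∣p∣>k⊎∣∁p∣>k {k} p with suc k ≤? ∣ p ∣
... | yes big = inj₁ big
... | no small with ≰⇒> small
... | s≤s ∣p∣≤k = inj₂ (begin
  suc k                ≡⟨ sym (m+n∸m≡n k (suc k)) ⟩
  k + suc k ∸ k        ≤⟨ ∸-monoʳ-≤ (k + suc k) ∣p∣≤k ⟩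
  k + suc k ∸ ∣ p ∣    ≡⟨ sym (∣∁p∣≡n∸∣p∣ p) ⟩
  ∣ ∁ p ∣              ∎)
  where open ≤-Reasoning

∪-monoˡ-⊆ : ∀ {p q r : Subset n} → p ⊆ q → p ∪ r ⊆ q ∪ r
∪-monoˡ-⊆ p⊆q x∈ = x∈p∪q⁺ (Sum.map p⊆q id (x∈p∪q⁻ _ _ x∈))

∪-monoʳ-⊆ : ∀ {p q r : Subset n} → q ⊆ r → p ∪ q ⊆ p ∪ r
∪-monoʳ-⊆ q⊆r x∈ = x∈p∪q⁺ (Sum.map id q⊆r (x∈p∪q⁻ _ _ x∈))

x∈⋃⁺ : ∀ {A : Set} (g : A → Subset n) (as : List A) {a x} →
       a List.∈ as → x ∈ g a → x ∈ ⋃ (map g as)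
x∈⋃⁺ g (_ ∷ₗ _)  (hereₗ refl) x∈ga = x∈p∪q⁺ (inj₁ x∈ga)
x∈⋃⁺ g (_ ∷ₗ as) (thereₗ a∈as) x∈ga = x∈p∪q⁺ (inj₂ (x∈⋃⁺ g as a∈as x∈ga))

x∈⋃⁻ : ∀ {A : Set} (g : A → Subset n) (as : List A) {x} →
       x ∈ ⋃ (map g as) → ∃ λ a → x ∈ g a
x∈⋃⁻ g []ₗ        x∈⋃ = contradiction x∈⋃ ∉⊥
x∈⋃⁻ g (a ∷ₗ as) x∈⋃ = [ (a ,_) , x∈⋃⁻ g as ]′ (x∈p∪q⁻ (g a) _ x∈⋃)

module _ (f : Fin m → Fin n) where

  private
    singletonIf : Subset m → Fin m → Subset n
    singletonIf Y i = if lookup Y i then ⁅ f i ⁆ else ⊥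

  image⁺ : ∀ {Y i} → i ∈ Y → f i ∈ image f Y
  image⁺ {Y} {i} i∈Y = x∈⋃⁺ (singletonIf Y) (allFin m) (∈-allFin i) fi∈
    where
      fi∈ : f i ∈ singletonIf Y i
      fi∈ rewrite []=⇒lookup i∈Y = x∈⁅x⁆ (f i)

  image⁻ : ∀ {Y x} → x ∈ image f Y → ∃ λ i → i ∈ Y × f i ≡ x
  image⁻ {Y} x∈fY with x∈⋃⁻ (singletonIf Y) (allFin m) x∈fY
  ... | i , x∈ with lookup Y i in eq
  ... | true  = i , lookup⇒[]= i Y eq , sym (x∈⁅y⁆⇒x≡y (f i) x∈)
  ... | false = contradiction x∈ ∉⊥

  image-mono : ∀ {Y Z} → Y ⊆ Z → image f Y ⊆ image f Z
  image-mono Y⊆Z x∈fY with image⁻ x∈fY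
  ... | i , i∈Y , refl = image⁺ (Y⊆Z i∈Y)

  preimage : Subset n → Subset m
  preimage X = tabulate (λ i → lookup X (f i))

  preimage⁺ : ∀ {X i} → f i ∈ X → i ∈ preimage X
  preimage⁺ {X} {i} fi∈X =
    lookup⇒[]= i (preimage X) (trans (lookup∘tabulate _ i) ([]=⇒lookup fi∈X))

  preimage⁻ : ∀ {X i} → i ∈ preimage X → f i ∈ X
  preimage⁻ {X} {i} i∈ =
    lookup⇒[]= (f i) X (trans (sym (lookup∘tabulate _ i)) ([]=⇒lookup i∈))

  image-preimage-⊆ : ∀ X → image f (preimage X) ⊆ X
  image-preimage-⊆ X x∈ with image⁻ {preimage X} x∈
  ... | i , i∈ , refl = preimage⁻ {X} i∈

  ∁-preimage-⊆ : ∀ {S X} → (∀ i → f i ∈ S) → ∁ (preimage X) ⊆ preimage (S ─ X)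
  ∁-preimage-⊆ f∈S {i} i∈∁ =
    preimage⁺ (x∈p∧x∉q⇒x∈p─q (f∈S i) (x∈∁p⇒x∉p i∈∁ ∘ preimage⁺))

module _ (M : Matroid n) where

  private
    r = rank M

  InClosure-mono : ∀ {A U x} → A ⊆ U → InClosure M A x → InClosure M U x
  InClosure-mono {A} {U} {x} A⊆U x∈clA =
    ≤-antisym (+-cancelʳ-≤ (r A) (r (U ∪ ⁅ x ⁆)) (r U) submod) (rank-mono M (p⊆p∪q _))
    where
      open ≤-Reasoning
      Ax = A ∪ ⁅ x ⁆
      submod : r (U ∪ ⁅ x ⁆) + r A ≤ r U + r A
      submod = begin
        r (U ∪ ⁅ x ⁆) + r A       ≤⟨ +-mono-≤ (rank-mono M (∪-monoʳ-⊆ (q⊆p∪q A ⁅ x ⁆)))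
                                                  (rank-mono M (λ a → x∈p∩q⁺ (A⊆U a , p⊆p∪q ⁅ x ⁆ a))) ⟩
        r (U ∪ Ax) + r (U ∩ Ax)   ≤⟨ rank-submod M U Ax ⟩
        r U + r Ax                ≡⟨ cong (r U +_) x∈clA ⟩
        r U + r A                 ∎

  InClosure-of-spanning : ∀ {A B x} → A ⊆ B → r B ≤ r A → InClosure M B x → InClosure M A x
  InClosure-of-spanning {A} {B} {x} A⊆B rB≤rA x∈clB =
    ≤-antisym (begin
      r (A ∪ ⁅ x ⁆)  ≤⟨ rank-mono M (∪-monoˡ-⊆ A⊆B) ⟩
      r (B ∪ ⁅ x ⁆)  ≡⟨ x∈clB ⟩
      r B            ≤⟨ rB≤rA ⟩
      r A            ∎)
      (rank-mono M (p⊆p∪q _))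
    where open ≤-Reasoning

  connectivity-complement : ∀ {S X} → X ⊆ S → connectivity M S (S ─ X) ≡ connectivity M S X
  connectivity-complement {S} {X} X⊆S = begin
    r (S ─ X) + r (S ─ (S ─ X)) ∸ r S  ≡⟨ cong (λ Y → r (S ─ X) + r Y ∸ r S) (p─[p─q]≡q X⊆S) ⟩
    r (S ─ X) + r X ∸ r S              ≡⟨ cong (_∸ r S) (+-comm (r (S ─ X)) (r X)) ⟩
    r X + r (S ─ X) ∸ r S              ∎
    where open ≡-Reasoning

  IsSeparation-complement : ∀ {S k X} → IsSeparation M S k X → IsSeparation M S k (S ─ X)
  IsSeparation-complement {S} {k} {X} (X⊆S , k≤∣X∣ , k≤∣S─X∣ , λ<k) =
    p─q⊆p S X ,
    k≤∣S─X∣ ,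
    subst (λ Y → k ≤ ∣ Y ∣) (sym (p─[p─q]≡q X⊆S)) k≤∣X∣ ,
    subst (_< k) (sym (connectivity-complement X⊆S)) λ<k

  IsSeparation-extend : ∀ {p k X} → IsSeparation M (⊤ - p) k X → InClosure M X p →
                        IsSeparation M ⊤ k (X ∪ ⁅ p ⁆)
  IsSeparation-extend {p} {k} {X} (_ , k≤∣X∣ , k≤∣W∣ , λ<k) p∈clX =
    ⊆-max (X ∪ ⁅ p ⁆) ,
    ≤-trans k≤∣X∣ (∣p∣≤∣p∪q∣ X ⁅ p ⁆) ,
    subst (λ Y → k ≤ ∣ Y ∣) W≡ k≤∣W∣ ,
    ≤-<-trans λ≤ λ<k
    where
      W≡ : (⊤ - p) ─ X ≡ ⊤ ─ (X ∪ ⁅ p ⁆)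
      W≡ = trans (p─q─r≡p─q∪r ⊤ ⁅ p ⁆ X) (cong (⊤ ─_) (∪-comm ⁅ p ⁆ X))
      open ≤-Reasoning
      λ≤ : connectivity M ⊤ (X ∪ ⁅ p ⁆) ≤ connectivity M (⊤ - p) X
      λ≤ = begin
        r (X ∪ ⁅ p ⁆) + r (⊤ ─ (X ∪ ⁅ p ⁆)) ∸ r ⊤  ≡⟨ cong₂ (λ a Y → a + r Y ∸ r ⊤) p∈clX (sym W≡) ⟩
        r X + r ((⊤ - p) ─ X) ∸ r ⊤              ≤⟨ ∸-monoʳ-≤ _ (rank-mono M (⊆-max (⊤ - p))) ⟩
        r X + r ((⊤ - p) ─ X) ∸ r (⊤ - p)        ∎

InClosure-of-uniform : ∀ (M : Matroid n) {P Z x r m} (iso : RestrictionIsoUniform M P r m) →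
                       r ≤ m → r ≤ ∣ preimage (proj₁ iso) Z ∣ →
                       InClosure M P x → InClosure M Z x
InClosure-of-uniform M {P} {Z} {r = r} {m} (f , _ , f⊤≡P , rank-f) r≤m r≤∣Y∣ x∈clP =
  InClosure-mono M (image-preimage-⊆ f Z)
    (InClosure-of-spanning M A⊆P (≤-reflexive rP≡rA) x∈clP)
  where
    Y = preimage f Z
    A = image f Y
    A⊆P : A ⊆ P
    A⊆P = subst (A ⊆_) f⊤≡P (image-mono f (⊆-max Y))
    open ≡-Reasoning
    rP≡rA : rank M P ≡ rank M A
    rP≡rA = begin
      rank M P           ≡⟨ cong (rank M) (sym f⊤≡P) ⟩
      rank M (image f ⊤) ≡⟨ rank-f ⊤ ⟩
      ∣ ⊤ {m} ∣ ⊓ r      ≡⟨ cong (_⊓ r) (∣⊤∣≡n m) ⟩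
      m ⊓ r              ≡⟨ m≥n⇒m⊓n≡n r≤m ⟩
      r                  ≡⟨ sym (m≥n⇒m⊓n≡n r≤∣Y∣) ⟩
      ∣ Y ∣ ⊓ r          ≡⟨ sym (rank-f Y) ⟩
      rank M A           ∎

lemma4p1 : ∀ {n} (M : Matroid n) (P : Subset n) →
    ThreeConnected M →
    RestrictionIsoUniform M P 3 5 →
    ∀ (p : Fin n) → InClosure M P p → p ∉ P →
    ThreeConnectedOn M (⊤ - p)
lemma4p1 M P M-3conn iso@(f , _ , f⊤≡P , _) p p∈clP p∉P k 1≤k k<3 X sep =
  [ no-separation X sep
  , no-separation W (IsSeparation-complement M sep) ∘ three-in-W
  ]′ (∣p∣>k⊎∣∁p∣>k (preimage f X))
  where
    W = (⊤ - p) ─ X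

    no-separation : ∀ Z → IsSeparation M (⊤ - p) k Z → ¬ 2 < ∣ preimage f Z ∣
    no-separation Z sepZ three-in-Z =
      M-3conn k 1≤k k<3 (Z ∪ ⁅ p ⁆) (IsSeparation-extend M sepZ
        (InClosure-of-uniform M {Z = Z} {p} {r = 3} iso (m≤m+n 3 2) three-in-Z p∈clP))

    f∈S : ∀ i → f i ∈ ⊤ - p
    f∈S i = x∈p∧x≢y⇒x∈p-y ∈⊤ λ { refl → p∉P (subst (f i ∈_) f⊤≡P (image⁺ f {⊤} ∈⊤)) }

    three-in-W : 2 < ∣ ∁ (preimage f X) ∣ → 2 < ∣ preimage f W ∣
    three-in-W three-in-∁ = ≤-trans three-in-∁ (p⊆q⇒∣p∣≤∣q∣ (∁-preimage-⊆ f {X = X} f∈S))
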